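{- Let $\mathbb K$ be a field of characteristic zero, $\mathfrak d$ a delta operator on $\mathbb K[x]$, $\mathcal Z=(z_i)_{i\ge0}$ a sequence in $\mathbb K$, and $(t_n(x))_{n\ge0}$ the generalized Gončarov basis associated with $(\mathfrak d,\mathcal Z)$. Then $(t_n(x))_{n\ge0}$ is of binomial type if and only if $\mathcal Z$ is an arithmetic progression with initial term $0$, i.e. there is $b\in\mathbb K$ with $z_i=ib$ for all $i$.
   Context: A sequence $(t_n)_{n\ge0}$ of polynomials is of binomial type if $t_n(x+y)=\sum_{k=0}^n\binom nk t_k(x)t_{n-k}(y)$ for all $n$. A shift-invariant operator on $\mathbb K[x]$ is a linear operator commuting with all shifts $f(x)\mapsto f(x+a)$; a delta operator is a shift-invariant operator $\mathfrak d$ with $\mathfrak d(x)$ a nonzero constant. The generalized Gončarov basis associated with $(\mathfrak d,\mathcal Z)$ is the unique sequence of polynomials $(t_n)_{n\ge0}$ with $\deg t_n=n$ and $\varepsilon_{z_i}(\mathfrak d^i t_n)=n!\,\delta_{i,n}$ for all $i,n$ ($\varepsilon_z$ evaluation at $z$, $\mathfrak d^i$ the $i$-th iterate). -}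

module Defs where

open import Level using (Level; _⊔_) renaming (suc to lsuc)
open import Algebra.Bundles using (CommutativeRing)
open import Data.Nat.Base as ℕ using (ℕ; zero; suc; _!)
open import Data.Nat.Combinatorics using (_C_)
open import Data.List.Base using (List; []; _∷_)
open import Data.Product using (Σ; ∃; _×_; _,_)
open import Relation.Nullary using (¬_; does)
open import Data.Bool.Base using (if_then_else_)
open import Data.Nat.Properties using (_≟_)

record Field (c ℓ : Level) : Set (lsuc (c ⊔ ℓ)) where
  field
    commutativeRing : CommutativeRing c ℓ
  open CommutativeRing commutativeRing public
  field
    0≉1     : ¬ (0# ≈ 1#)
    inverse : ∀ x → ¬ (x ≈ 0#) → Σ Carrier (λ y → x * y ≈ 1#)

module FieldTheory {c ℓ : Level} (F : Field c ℓ) where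
  open Field F public

  fromℕ : ℕ → Carrier
  fromℕ zero    = 0#
  fromℕ (suc n) = 1# + fromℕ n

  CharZero : Set ℓ
  CharZero = ∀ n → ¬ (fromℕ (suc n) ≈ 0#)

  -- Polynomials in K[x] as coefficient lists (constant term first);
  -- trailing zeros are allowed, equality is coefficientwise.
  Poly : Set c
  Poly = List Carrier

  coeff : Poly → ℕ → Carrier
  coeff []       _       = 0#
  coeff (a ∷ p)  zero    = a
  coeff (a ∷ p)  (suc n) = coeff p n

  _≈P_ : Poly → Poly → Set ℓ
  p ≈P q = ∀ n → coeff p n ≈ coeff q n

  _+P_ : Poly → Poly → Poly
  []      +P q       = q
  (a ∷ p) +P []      = a ∷ p
  (a ∷ p) +P (b ∷ q) = (a + b) ∷ (p +P q)

  _·P_ : Carrier → Poly → Poly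
  k ·P []      = []
  k ·P (a ∷ p) = (k * a) ∷ (k ·P p)

  const : Carrier → Poly
  const a = a ∷ []

  X : Poly
  X = 0# ∷ 1# ∷ []

  eval : Carrier → Poly → Carrier
  eval a []      = 0#
  eval a (b ∷ p) = b + a * eval a p

  mulXplus : Carrier → Poly → Poly
  mulXplus a p = (0# ∷ p) +P (a ·P p)

  shift : Carrier → Poly → Poly
  shift a []      = []
  shift a (b ∷ p) = const b +P mulXplus a (shift a p)

  Op : Set c
  Op = Poly → Poly

  record IsLinear (L : Op) : Set (c ⊔ ℓ) where
    field
      cong-≈P : ∀ p q → p ≈P q → L p ≈P L q
      additive : ∀ p q → L (p +P q) ≈P (L p +P L q)
      homogeneous : ∀ k p → L (k ·P p) ≈P (k ·P L p)

  record IsShiftInvariant (L : Op) : Set (c ⊔ ℓ) where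
    field
      linear : IsLinear L
      commutes : ∀ a p → L (shift a p) ≈P shift a (L p)

  record IsDeltaOperator (L : Op) : Set (c ⊔ ℓ) where
    field
      shiftInvariant : IsShiftInvariant L
      constant : Carrier
      constant≉0 : ¬ (constant ≈ 0#)
      onX : L X ≈P const constant

  iter : Op → ℕ → Op
  iter L zero    p = p
  iter L (suc i) p = L (iter L i p)

  HasDegree : Poly → ℕ → Set ℓ
  HasDegree p n = ¬ (coeff p n ≈ 0#) × (∀ m → n ℕ.< m → coeff p m ≈ 0#)

  factδ : ℕ → ℕ → Carrier
  factδ i n = if does (i ≟ n) then fromℕ (n !) else 0#

  record IsGoncharovBasis (d : Op) (z : ℕ → Carrier) (t : ℕ → Poly) : Set ℓ where
    field
      degree : ∀ n → HasDegree (t n) n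
      interpolation : ∀ i n → eval (z i) (iter d i (t n)) ≈ factδ i n

  sumTo : ℕ → (ℕ → Carrier) → Carrier
  sumTo zero    f = f 0
  sumTo (suc n) f = sumTo n f + f (suc n)

  IsBinomialType : (ℕ → Poly) → Set (c ⊔ ℓ)
  IsBinomialType t = ∀ n x y →
    eval (x + y) (t n) ≈ sumTo n (λ k → fromℕ (n C k) * (eval x (t k) * eval y (t (n ℕ.∸ k))))

module Submission where

-- Both conditions are equivalent to the identity
--   m! · (𝔡ⁱ t_{i+m})(z_i + y) = (i+m)! · t_m(y)   for all i, m and y.
-- The tool throughout is uniqueness of interpolation: in characteristic zero 𝔡 lowers degrees by
-- exactly one, so a polynomial p of degree ≤ n is determined by the values (𝔡ⁱ p)(z_i), i ≤ n.
-- Binomial type says that, as polynomials in x, t_n(x + y) = Σ_k C(n,k) t_{n-k}(y) t_k(x); the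
-- interpolation data of the right-hand side are C(n,i) i! t_{n-i}(y), so this holds exactly when
-- the identity does. If z_i = i b, uniqueness gives (𝔡 t_{m+1})(x + b) = (m+1) t_m(x), and iterating
-- this yields the identity. Conversely, the identity for (i, m) = (0, 1) forces z_0 = 0; for m = 2
-- it makes x ↦ (𝔡ⁱ t_{i+2})(z_i + x) a nonzero multiple of t_2, so applying 𝔡 and evaluating at
-- x = z_{i+1} − z_i shows that z_{i+1} − z_i is a root of the linear polynomial 𝔡 t_2, whose only
-- root is z_1.

open import Defs
open import Level using (Level; _⊔_)
open import Data.Nat.Base as ℕ using (ℕ; zero; suc; _!; _∸_; _≤_; _<_; z≤n; s≤s)
import Data.Nat.Properties as ℕ
open import Data.Nat.Combinatorics using (_C_; nCk≡n!/k![n-k]!; k![n∸k]!∣n!)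
open import Data.Nat.DivMod using (_/_; m/n*n≡m)
open import Data.List.Base using ([]; _∷_; length)
open import Data.Product using (Σ; _,_; proj₁; proj₂)
open import Data.Sum using (inj₁; inj₂)
open import Function.Bundles using (_⇔_; mk⇔)
open import Relation.Nullary using (¬_; yes; no)
open import Relation.Nullary.Decidable using (dec-true; dec-false)
open import Relation.Binary.PropositionalEquality as ≡ using (_≡_; _≢_)

binomial-factorials : ∀ i m → ((i ℕ.+ m) C i) ℕ.* (i ! ℕ.* m !) ≡ (i ℕ.+ m) !
binomial-factorials i m = begin
  ((i ℕ.+ m) C i) ℕ.* (i ! ℕ.* m !)
    ≡⟨ ≡.cong (λ k → ((i ℕ.+ m) C i) ℕ.* (i ! ℕ.* k !)) (ℕ.m+n∸m≡n i m) ⟨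
  ((i ℕ.+ m) C i) ℕ.* fact
    ≡⟨ ≡.cong (ℕ._* fact) (nCk≡n!/k![n-k]! i≤i+m) ⟩
  ((i ℕ.+ m) ! / fact) ℕ.* fact
    ≡⟨ m/n*n≡m (k![n∸k]!∣n! i≤i+m) ⟩
  (i ℕ.+ m) !
    ∎
  where
  open ≡.≡-Reasoning
  i≤i+m = ℕ.m≤m+n i m
  fact = i ! ℕ.* (i ℕ.+ m ∸ i) !
  instance _ = i ℕ.!* (i ℕ.+ m ∸ i) !≢0

module FieldProperties {c ℓ : Level} (F : Field c ℓ) where
  open FieldTheory F hiding (zero)
  open import Algebra.Properties.Semiring.Mult semiring using (_×_; ×1-homo-*)
  open import Algebra.Solver.Ring.NaturalCoefficients.Default commutativeSemiring
    using (solve; _:=_; _:+_; _:*_; con)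
  open import Relation.Binary.Reasoning.Setoid setoid

  *-cancelˡ : ∀ {a x y} → ¬ (a ≈ 0#) → a * x ≈ a * y → x ≈ y
  *-cancelˡ {a} {x} {y} a≉0 ax≈ay with inverse a a≉0
  ... | a⁻¹ , aa⁻¹≈1 = begin
    x              ≈⟨ undo x ⟨
    a⁻¹ * (a * x)  ≈⟨ *-congˡ ax≈ay ⟩
    a⁻¹ * (a * y)  ≈⟨ undo y ⟩
    y              ∎
    where
    undo : ∀ u → a⁻¹ * (a * u) ≈ u
    undo u = begin
      a⁻¹ * (a * u)  ≈⟨ solve 3 (λ a b u → b :* (a :* u) := (a :* b) :* u) refl a a⁻¹ u ⟩
      (a * a⁻¹) * u  ≈⟨ *-congʳ aa⁻¹≈1 ⟩
      1# * u         ≈⟨ *-identityˡ u ⟩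
      u              ∎

  *-zero-cancelˡ : ∀ {a x} → ¬ (a ≈ 0#) → a * x ≈ 0# → x ≈ 0#
  *-zero-cancelˡ {a} a≉0 ax≈0 = *-cancelˡ a≉0 (trans ax≈0 (sym (zeroʳ a)))

  *-nonzero : ∀ {a b} → ¬ (a ≈ 0#) → ¬ (b ≈ 0#) → ¬ (a * b ≈ 0#)
  *-nonzero a≉0 b≉0 ab≈0 = b≉0 (*-zero-cancelˡ a≉0 ab≈0)

  [x-y]+y≈x : ∀ x y → (x + - y) + y ≈ x
  [x-y]+y≈x x y = begin
    (x + - y) + y  ≈⟨ +-assoc x (- y) y ⟩
    x + (- y + y)  ≈⟨ +-congˡ (-‿inverseˡ y) ⟩
    x + 0#         ≈⟨ +-identityʳ x ⟩
    x              ∎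

  fromℕ≡×1# : ∀ n → fromℕ n ≡ n × 1#
  fromℕ≡×1# zero    = ≡.refl
  fromℕ≡×1# (suc n) = ≡.cong (1# +_) (fromℕ≡×1# n)

  fromℕ-* : ∀ m n → fromℕ (m ℕ.* n) ≈ fromℕ m * fromℕ n
  fromℕ-* m n rewrite fromℕ≡×1# (m ℕ.* n) | fromℕ≡×1# m | fromℕ≡×1# n = ×1-homo-* m n

  fromℕ-suc-* : ∀ n b → fromℕ (suc n) * b ≈ fromℕ n * b + b
  fromℕ-suc-* n b = solve 2 (λ n b → (con 1 :+ n) :* b := n :* b :+ b) refl (fromℕ n) b

  fromℕ[n!]≉0 : CharZero → ∀ n → ¬ (fromℕ (n !) ≈ 0#)
  fromℕ[n!]≉0 char0 zero    = char0 0
  fromℕ[n!]≉0 char0 (suc n) n!≈0 =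
    *-nonzero (char0 n) (fromℕ[n!]≉0 char0 n) (trans (sym (fromℕ-* (suc n) (n !))) n!≈0)

  arithmetic⇒step : ∀ {z : ℕ → Carrier} {b} → (∀ i → z i ≈ fromℕ i * b) → ∀ i → z (suc i) ≈ z i + b
  arithmetic⇒step z≈ib i = trans (z≈ib (suc i)) (trans (fromℕ-suc-* i _) (+-congʳ (sym (z≈ib i))))

  step⇒arithmetic : ∀ {z : ℕ → Carrier} {b} →
    z 0 ≈ 0# → (∀ i → z (suc i) ≈ z i + b) → ∀ i → z i ≈ fromℕ i * b
  step⇒arithmetic {b = b} z₀≈0 step zero    = trans z₀≈0 (sym (zeroˡ b))
  step⇒arithmetic {b = b} z₀≈0 step (suc i) =
    trans (step i) (trans (+-congʳ (step⇒arithmetic z₀≈0 step i)) (sym (fromℕ-suc-* i b)))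

module PolynomialProperties {c ℓ : Level} (F : Field c ℓ) where
  open FieldTheory F hiding (zero)
  open FieldProperties F
  open import Algebra.Properties.Ring ring using (-1*x≈-x)
  open import Algebra.Properties.Group +-group using (∙-cancelˡ; x∙y⁻¹≈ε⇒x≈y)
  open import Algebra.Properties.AbelianGroup +-abelianGroup using (xyx⁻¹≈y)
  open import Algebra.Solver.Ring.NaturalCoefficients.Default commutativeSemiring
    using (solve; _:=_; _:+_; _:*_; con)
  open import Relation.Binary.Reasoning.Setoid setoid

  coeff-+P : ∀ p q n → coeff (p +P q) n ≈ coeff p n + coeff q n
  coeff-+P []      q       n       = sym (+-identityˡ _)
  coeff-+P (a ∷ p) []      n       = sym (+-identityʳ _)
  coeff-+P (a ∷ p) (b ∷ q) zero    = refl
  coeff-+P (a ∷ p) (b ∷ q) (suc n) = coeff-+P p q n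

  coeff-·P : ∀ k p n → coeff (k ·P p) n ≈ k * coeff p n
  coeff-·P k []      n       = sym (zeroʳ k)
  coeff-·P k (a ∷ p) zero    = refl
  coeff-·P k (a ∷ p) (suc n) = coeff-·P k p n

  private
    0+x*0≈0 : ∀ x → 0# + x * 0# ≈ 0#
    0+x*0≈0 = solve 1 (λ x → con 0 :+ x :* con 0 := con 0) refl

  eval-≈P[] : ∀ x p → p ≈P [] → eval x p ≈ 0#
  eval-≈P[] x []      _   = refl
  eval-≈P[] x (a ∷ p) p≈0 =
    trans (+-cong (p≈0 0) (*-congˡ (eval-≈P[] x p (λ n → p≈0 (suc n))))) (0+x*0≈0 x)

  eval-cong : ∀ x p q → p ≈P q → eval x p ≈ eval x q
  eval-cong x []      q       p≈q = sym (eval-≈P[] x q (λ n → sym (p≈q n)))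
  eval-cong x (a ∷ p) []      p≈q = eval-≈P[] x (a ∷ p) p≈q
  eval-cong x (a ∷ p) (b ∷ q) p≈q = +-cong (p≈q 0) (*-congˡ (eval-cong x p q (λ n → p≈q (suc n))))

  eval-at-cong : ∀ {x y} p → x ≈ y → eval x p ≈ eval y p
  eval-at-cong []      x≈y = refl
  eval-at-cong (a ∷ p) x≈y = +-congˡ (*-cong x≈y (eval-at-cong p x≈y))

  eval-+P : ∀ x p q → eval x (p +P q) ≈ eval x p + eval x q
  eval-+P x []      q       = sym (+-identityˡ _)
  eval-+P x (a ∷ p) []      = sym (+-identityʳ _)
  eval-+P x (a ∷ p) (b ∷ q) = begin
    (a + b) + x * eval x (p +P q)            ≈⟨ +-congˡ (*-congˡ (eval-+P x p q)) ⟩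
    (a + b) + x * (eval x p + eval x q)      ≈⟨ reorder a b x (eval x p) (eval x q) ⟩
    (a + x * eval x p) + (b + x * eval x q)  ∎
    where
    reorder : ∀ a b x u v → (a + b) + x * (u + v) ≈ (a + x * u) + (b + x * v)
    reorder = solve 5 (λ a b x u v → (a :+ b) :+ x :* (u :+ v) := (a :+ x :* u) :+ (b :+ x :* v)) refl

  eval-·P : ∀ x k p → eval x (k ·P p) ≈ k * eval x p
  eval-·P x k []      = sym (zeroʳ k)
  eval-·P x k (a ∷ p) = begin
    k * a + x * eval x (k ·P p)  ≈⟨ +-congˡ (*-congˡ (eval-·P x k p)) ⟩
    k * a + x * (k * eval x p)   ≈⟨ reorder k a x (eval x p) ⟩
    k * (a + x * eval x p)       ∎
    where
    reorder : ∀ k a x u → k * a + x * (k * u) ≈ k * (a + x * u)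
    reorder = solve 4 (λ k a x u → k :* a :+ x :* (k :* u) := k :* (a :+ x :* u)) refl

  eval-const : ∀ x k → eval x (const k) ≈ k
  eval-const x k = trans (+-congˡ (zeroʳ x)) (+-identityʳ k)

  eval-shift : ∀ a y p → eval y (shift a p) ≈ eval (y + a) p
  eval-shift a y []      = refl
  eval-shift a y (b ∷ p) = begin
    eval y (const b +P mulXplus a s)          ≈⟨ eval-+P y (const b) (mulXplus a s) ⟩
    eval y (const b) + eval y (mulXplus a s)  ≈⟨ +-cong (eval-const y b) (eval-+P y (0# ∷ s) (a ·P s)) ⟩
    b + (eval y (0# ∷ s) + eval y (a ·P s))   ≈⟨ +-congˡ (+-congˡ (eval-·P y a s)) ⟩
    b + ((0# + y * eval y s) + a * eval y s)  ≈⟨ reorder b y a (eval y s) ⟩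
    b + (y + a) * eval y s                    ≈⟨ +-congˡ (*-congˡ (eval-shift a y p)) ⟩
    b + (y + a) * eval (y + a) p              ∎
    where
    s = shift a p
    reorder : ∀ b y a u → b + ((0# + y * u) + a * u) ≈ b + (y + a) * u
    reorder = solve 4 (λ b y a u → b :+ ((con 0 :+ y :* u) :+ a :* u) := b :+ (y :+ a) :* u) refl

  shift-X : ∀ a → shift a X ≈P (X +P const a)
  shift-X a zero          = solve 1 (λ a → con 0 :+ (con 0 :+ a :* (con 1 :+ con 0)) := con 0 :+ a) refl a
  shift-X a (suc zero)    = +-identityʳ 1#
  shift-X a (suc (suc n)) = refl

  _-P_ : Poly → Poly → Poly
  p -P q = p +P ((- 1#) ·P q)

  coeff--P : ∀ p q n → coeff (p -P q) n ≈ coeff p n + - coeff q n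
  coeff--P p q n = trans (coeff-+P p ((- 1#) ·P q) n) (+-congˡ (trans (coeff-·P (- 1#) q n) (-1*x≈-x _)))

  eval--P : ∀ x p q → eval x (p -P q) ≈ eval x p + - eval x q
  eval--P x p q = trans (eval-+P x p ((- 1#) ·P q)) (+-congˡ (trans (eval-·P x (- 1#) q) (-1*x≈-x _)))

  -P≈P[]⇒≈P : ∀ p q → (p -P q) ≈P [] → p ≈P q
  -P≈P[]⇒≈P p q p-q≈0 n = x∙y⁻¹≈ε⇒x≈y _ _ (trans (sym (coeff--P p q n)) (p-q≈0 n))

  sumP : ℕ → (ℕ → Poly) → Poly
  sumP zero    f = f 0
  sumP (suc n) f = sumP n f +P f (suc n)

  eval-sumP : ∀ x n f → eval x (sumP n f) ≈ sumTo n (λ k → eval x (f k))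
  eval-sumP x zero    f = refl
  eval-sumP x (suc n) f = trans (eval-+P x (sumP n f) (f (suc n))) (+-congʳ (eval-sumP x n f))

  sumTo-cong : ∀ n {f g : ℕ → Carrier} → (∀ k → f k ≈ g k) → sumTo n f ≈ sumTo n g
  sumTo-cong zero    f≈g = f≈g 0
  sumTo-cong (suc n) f≈g = +-cong (sumTo-cong n f≈g) (f≈g (suc n))

  sumTo-zero : ∀ n {f : ℕ → Carrier} → (∀ k → k ≤ n → f k ≈ 0#) → sumTo n f ≈ 0#
  sumTo-zero zero    f≈0 = f≈0 0 z≤n
  sumTo-zero (suc n) f≈0 = trans (+-cong (sumTo-zero n (λ k k≤n → f≈0 k (ℕ.m≤n⇒m≤1+n k≤n)))
                                         (f≈0 (suc n) ℕ.≤-refl))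
                                 (+-identityʳ 0#)

  sumTo-single : ∀ {n i} (f : ℕ → Carrier) → i ≤ n → (∀ k → k ≢ i → f k ≈ 0#) → sumTo n f ≈ f i
  sumTo-single {zero}      f z≤n   _   = refl
  sumTo-single {suc n} {i} f i≤1+n off with ℕ.m≤n⇒m<n∨m≡n i≤1+n
  ... | inj₁ (s≤s i≤n) =
    trans (+-cong (sumTo-single f i≤n off) (off (suc n) (ℕ.>⇒≢ (s≤s i≤n)))) (+-identityʳ _)
  ... | inj₂ ≡.refl    =
    trans (+-congʳ (sumTo-zero n (λ k k≤n → off k (ℕ.<⇒≢ (s≤s k≤n))))) (+-identityˡ _)

  module LinearOperator {L : Op} (linear : IsLinear L) where
    open IsLinear linear

    L-sumP : ∀ n f → L (sumP n f) ≈P sumP n (λ k → L (f k))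
    L-sumP zero    f m = refl
    L-sumP (suc n) f m = begin
      coeff (L (sumP n f +P f (suc n))) m              ≈⟨ additive (sumP n f) (f (suc n)) m ⟩
      coeff (L (sumP n f) +P L (f (suc n))) m          ≈⟨ coeff-+P (L (sumP n f)) (L (f (suc n))) m ⟩
      coeff (L (sumP n f)) m + coeff (L (f (suc n))) m ≈⟨ +-congʳ (L-sumP n f m) ⟩
      coeff (Lf-sum) m + coeff (L (f (suc n))) m       ≈⟨ coeff-+P Lf-sum (L (f (suc n))) m ⟨
      coeff (Lf-sum +P L (f (suc n))) m                ∎
      where Lf-sum = sumP n (λ k → L (f k))

    L--P : ∀ p q → L (p -P q) ≈P (L p -P L q)
    L--P p q m = begin
      coeff (L (p +P ((- 1#) ·P q))) m           ≈⟨ additive p ((- 1#) ·P q) m ⟩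
      coeff (L p +P L ((- 1#) ·P q)) m           ≈⟨ coeff-+P (L p) (L ((- 1#) ·P q)) m ⟩
      coeff (L p) m + coeff (L ((- 1#) ·P q)) m  ≈⟨ +-congˡ (homogeneous (- 1#) q m) ⟩
      coeff (L p) m + coeff ((- 1#) ·P L q) m    ≈⟨ coeff-+P (L p) ((- 1#) ·P L q) m ⟨
      coeff (L p -P L q) m                       ∎

    eval-L-cong : ∀ x p q → p ≈P q → eval x (L p) ≈ eval x (L q)
    eval-L-cong x p q p≈q = eval-cong x (L p) (L q) (cong-≈P p q p≈q)

    eval-L-·P : ∀ x k p → eval x (L (k ·P p)) ≈ k * eval x (L p)
    eval-L-·P x k p = trans (eval-cong x (L (k ·P p)) (k ·P L p) (homogeneous k p)) (eval-·P x k (L p))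

  iterate-isLinear : ∀ {L} → IsLinear L → ∀ i → IsLinear (iter L i)
  iterate-isLinear linear zero    = record
    { cong-≈P     = λ p q p≈q → p≈q
    ; additive    = λ p q n → refl
    ; homogeneous = λ k p n → refl
    }
  iterate-isLinear {L} linear (suc i) = record
    { cong-≈P     = λ p q p≈q → cong-≈P _ _ (Lⁱ.cong-≈P p q p≈q)
    ; additive    = λ p q n → trans (cong-≈P _ _ (Lⁱ.additive p q) n) (additive (iter L i p) (iter L i q) n)
    ; homogeneous = λ k p n → trans (cong-≈P _ _ (Lⁱ.homogeneous k p) n) (homogeneous k (iter L i p) n)
    }
    where
    open IsLinear linear
    module Lⁱ = IsLinear (iterate-isLinear linear i)

  iter-suc : ∀ L i p → iter L (suc i) p ≡ iter L i (L p)
  iter-suc L zero    p = ≡.refl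
  iter-suc L (suc i) p = ≡.cong L (iter-suc L i p)

  record DegreeAtMost (p : Poly) (n : ℕ) : Set ℓ where
    constructor degree≤
    field vanishes : ∀ m → n < m → coeff p m ≈ 0#
  open DegreeAtMost public

  degree-length : ∀ p → DegreeAtMost p (length p)
  degree-length []      = degree≤ (λ m _ → refl)
  degree-length (a ∷ p) = degree≤ λ { (suc m) (s≤s n<m) → vanishes (degree-length p) m n<m }

  degree-mono : ∀ {p m n} → m ≤ n → DegreeAtMost p m → DegreeAtMost p n
  degree-mono m≤n deg = degree≤ λ k n<k → vanishes deg k (ℕ.≤-<-trans m≤n n<k)

  degree-cong : ∀ {p q n} → p ≈P q → DegreeAtMost p n → DegreeAtMost q n
  degree-cong p≈q deg = degree≤ λ m n<m → trans (sym (p≈q m)) (vanishes deg m n<m)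

  degree-+P : ∀ {p q n} → DegreeAtMost p n → DegreeAtMost q n → DegreeAtMost (p +P q) n
  degree-+P {p} {q} degp degq = degree≤ λ m n<m →
    trans (coeff-+P p q m) (trans (+-cong (vanishes degp m n<m) (vanishes degq m n<m)) (+-identityʳ 0#))

  degree-·P : ∀ {p n} k → DegreeAtMost p n → DegreeAtMost (k ·P p) n
  degree-·P {p} k deg = degree≤ λ m n<m → trans (coeff-·P k p m) (trans (*-congˡ (vanishes deg m n<m)) (zeroʳ k))

  degree--P : ∀ {p q n} → DegreeAtMost p n → DegreeAtMost q n → DegreeAtMost (p -P q) n
  degree--P degp degq = degree-+P degp (degree-·P (- 1#) degq)

  degree-sumP : ∀ n {f N} → (∀ k → k ≤ n → DegreeAtMost (f k) N) → DegreeAtMost (sumP n f) N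
  degree-sumP zero    deg = deg 0 z≤n
  degree-sumP (suc n) deg = degree-+P (degree-sumP n (λ k k≤n → deg k (ℕ.m≤n⇒m≤1+n k≤n))) (deg (suc n) ℕ.≤-refl)

  degree-pred : ∀ {p n} → DegreeAtMost p (suc n) → coeff p (suc n) ≈ 0# → DegreeAtMost p n
  degree-pred {p} {n} deg top≈0 = degree≤ vanish
    where
    vanish : ∀ m → n < m → coeff p m ≈ 0#
    vanish m n<m with ℕ.m≤n⇒m<n∨m≡n n<m
    ... | inj₁ 1+n<m  = vanishes deg m 1+n<m
    ... | inj₂ ≡.refl = top≈0

  degree-tail : ∀ {a p n} → DegreeAtMost (a ∷ p) (suc n) → DegreeAtMost p n
  degree-tail deg = degree≤ λ m n<m → vanishes deg (suc m) (s≤s n<m)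

  degree0-≈P[] : ∀ {p} → DegreeAtMost p 0 → coeff p 0 ≈ 0# → p ≈P []
  degree0-≈P[] deg p₀≈0 zero    = p₀≈0
  degree0-≈P[] deg p₀≈0 (suc n) = vanishes deg (suc n) (s≤s z≤n)

  eval-degree0 : ∀ x p → DegreeAtMost p 0 → eval x p ≈ coeff p 0
  eval-degree0 x []      deg = refl
  eval-degree0 x (a ∷ p) deg = begin
    a + x * eval x p  ≈⟨ +-congˡ (*-congˡ (eval-≈P[] x p (λ n → vanishes deg (suc n) (s≤s z≤n)))) ⟩
    a + x * 0#        ≈⟨ +-congˡ (zeroʳ x) ⟩
    a + 0#            ≈⟨ +-identityʳ a ⟩
    a                 ∎

  eval-degree1 : ∀ x p → DegreeAtMost p 1 → eval x p ≈ coeff p 0 + x * coeff p 1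
  eval-degree1 x []      deg = sym (0+x*0≈0 x)
  eval-degree1 x (a ∷ p) deg = +-congˡ (*-congˡ (eval-degree0 x p (degree-tail deg)))

  degree1-injective : ∀ {p u v} → DegreeAtMost p 1 → ¬ (coeff p 1 ≈ 0#) → eval u p ≈ eval v p → u ≈ v
  degree1-injective {p} {u} {v} deg p₁≉0 pu≈pv = *-cancelˡ p₁≉0 (begin
    coeff p 1 * u  ≈⟨ *-comm _ u ⟩
    u * coeff p 1  ≈⟨ ∙-cancelˡ (coeff p 0) _ _ (trans (sym (eval-degree1 u p deg))
                                                       (trans pu≈pv (eval-degree1 v p deg))) ⟩
    v * coeff p 1  ≈⟨ *-comm v _ ⟩
    coeff p 1 * v  ∎)

  coeff-shift-zero : ∀ a b p → coeff (shift a (b ∷ p)) 0 ≈ b + a * coeff (shift a p) 0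
  coeff-shift-zero a b p = begin
    coeff (const b +P mulXplus a s) 0  ≈⟨ coeff-+P (const b) (mulXplus a s) 0 ⟩
    b + coeff (mulXplus a s) 0         ≈⟨ +-congˡ (coeff-+P (0# ∷ s) (a ·P s) 0) ⟩
    b + (0# + coeff (a ·P s) 0)        ≈⟨ +-congˡ (+-identityˡ _) ⟩
    b + coeff (a ·P s) 0               ≈⟨ +-congˡ (coeff-·P a s 0) ⟩
    b + a * coeff s 0                  ∎
    where s = shift a p

  coeff-shift-suc : ∀ a b p n →
    coeff (shift a (b ∷ p)) (suc n) ≈ coeff (shift a p) n + a * coeff (shift a p) (suc n)
  coeff-shift-suc a b p n = begin
    coeff (const b +P mulXplus a s) (suc n)  ≈⟨ coeff-+P (const b) (mulXplus a s) (suc n) ⟩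
    0# + coeff (mulXplus a s) (suc n)        ≈⟨ +-identityˡ _ ⟩
    coeff (mulXplus a s) (suc n)             ≈⟨ coeff-+P (0# ∷ s) (a ·P s) (suc n) ⟩
    coeff s n + coeff (a ·P s) (suc n)       ≈⟨ +-congˡ (coeff-·P a s (suc n)) ⟩
    coeff s n + a * coeff s (suc n)          ∎
    where s = shift a p

  private
    u+a*v≈0 : ∀ {u v} a → u ≈ 0# → v ≈ 0# → u + a * v ≈ 0#
    u+a*v≈0 a u≈0 v≈0 = trans (+-cong u≈0 (*-congˡ v≈0)) (0+x*0≈0 a)

  shift-≈P[] : ∀ a p → p ≈P [] → shift a p ≈P []
  shift-≈P[] a []      p≈0 n       = refl
  shift-≈P[] a (b ∷ p) p≈0 zero    =
    trans (coeff-shift-zero a b p) (u+a*v≈0 a (p≈0 0) (shift-≈P[] a p (λ n → p≈0 (suc n)) 0))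
  shift-≈P[] a (b ∷ p) p≈0 (suc n) =
    trans (coeff-shift-suc a b p n) (u+a*v≈0 a (shiftp≈0 n) (shiftp≈0 (suc n)))
    where shiftp≈0 = shift-≈P[] a p (λ n → p≈0 (suc n))

  shift-degree : ∀ a p {n} → DegreeAtMost p n → DegreeAtMost (shift a p) n
  shift-degree a []      deg = degree≤ (λ m _ → refl)
  shift-degree a (b ∷ p) {zero} deg = degree≤ λ { (suc m) _ →
    trans (coeff-shift-suc a b p m) (u+a*v≈0 a (shiftp≈0 m) (shiftp≈0 (suc m))) }
    where shiftp≈0 = shift-≈P[] a p (λ n → vanishes deg (suc n) (s≤s z≤n))
  shift-degree a (b ∷ p) {suc n} deg = degree≤ λ { (suc m) (s≤s n<m) →
    trans (coeff-shift-suc a b p m)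
          (u+a*v≈0 a (vanishes shiftp m n<m) (vanishes shiftp (suc m) (ℕ.m<n⇒m<1+n n<m))) }
    where shiftp = shift-degree a p (degree-tail deg)

  coeff-shift-top : ∀ a p {n} → DegreeAtMost p n → coeff (shift a p) n ≈ coeff p n
  coeff-shift-top a []      deg = refl
  coeff-shift-top a (b ∷ p) {zero} deg = begin
    coeff (shift a (b ∷ p)) 0    ≈⟨ coeff-shift-zero a b p ⟩
    b + a * coeff (shift a p) 0  ≈⟨ +-congˡ (*-congˡ (shift-≈P[] a p (λ n → vanishes deg (suc n) (s≤s z≤n)) 0)) ⟩
    b + a * 0#                   ≈⟨ +-congˡ (zeroʳ a) ⟩
    b + 0#                       ≈⟨ +-identityʳ b ⟩
    b                            ∎
  coeff-shift-top a (b ∷ p) {suc n} deg = begin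
    coeff (shift a (b ∷ p)) (suc n)                      ≈⟨ coeff-shift-suc a b p n ⟩
    coeff (shift a p) n + a * coeff (shift a p) (suc n)  ≈⟨ +-cong (coeff-shift-top a p degp)
                                                                    (*-congˡ (vanishes (shift-degree a p degp) (suc n) ℕ.≤-refl)) ⟩
    coeff p n + a * 0#                                   ≈⟨ +-congˡ (zeroʳ a) ⟩
    coeff p n + 0#                                       ≈⟨ +-identityʳ _ ⟩
    coeff p n                                            ∎
    where degp = degree-tail deg

  coeff-shift-subtop : ∀ a p {n} → DegreeAtMost p (suc n) →
    coeff (shift a p) n ≈ coeff p n + fromℕ (suc n) * a * coeff p (suc n)
  coeff-shift-subtop a []      deg = sym (trans (+-identityˡ _) (zeroʳ _))
  coeff-shift-subtop a (b ∷ p) {zero} deg = begin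
    coeff (shift a (b ∷ p)) 0    ≈⟨ coeff-shift-zero a b p ⟩
    b + a * coeff (shift a p) 0  ≈⟨ +-congˡ (*-congˡ (coeff-shift-top a p (degree-tail deg))) ⟩
    b + a * coeff p 0            ≈⟨ solve 3 (λ b a u → b :+ a :* u := b :+ (con 1 :+ con 0) :* a :* u) refl b a (coeff p 0) ⟩
    b + fromℕ 1 * a * coeff p 0  ∎
  coeff-shift-subtop a (b ∷ p) {suc n} deg = begin
    coeff (shift a (b ∷ p)) (suc n)                      ≈⟨ coeff-shift-suc a b p n ⟩
    coeff (shift a p) n + a * coeff (shift a p) (suc n)  ≈⟨ +-cong (coeff-shift-subtop a p degp)
                                                                    (*-congˡ (coeff-shift-top a p degp)) ⟩
    (coeff p n + fromℕ (suc n) * a * u) + a * u          ≈⟨ reorder (coeff p n) (fromℕ (suc n)) a u ⟩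
    coeff p n + fromℕ (suc (suc n)) * a * u              ∎
    where
    degp = degree-tail deg
    u = coeff p (suc n)
    reorder : ∀ v k a u → (v + k * a * u) + a * u ≈ v + (1# + k) * a * u
    reorder = solve 4 (λ v k a u → (v :+ k :* a :* u) :+ a :* u := v :+ (con 1 :+ k) :* a :* u) refl

  Δ : Poly → Poly
  Δ p = shift 1# p -P p

  eval-Δ : ∀ y p → eval y (Δ p) ≈ eval (y + 1#) p + - eval y p
  eval-Δ y p = trans (eval--P y (shift 1# p) p) (+-congʳ (eval-shift 1# y p))

  Δ-degree : ∀ p {n} → DegreeAtMost p (suc n) → DegreeAtMost (Δ p) n
  Δ-degree p {n} deg = degree-pred (degree--P (shift-degree 1# p deg) deg) (begin
    coeff (Δ p) (suc n)                             ≈⟨ coeff--P (shift 1# p) p (suc n) ⟩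
    coeff (shift 1# p) (suc n) + - coeff p (suc n)  ≈⟨ +-congʳ (coeff-shift-top 1# p deg) ⟩
    coeff p (suc n) + - coeff p (suc n)             ≈⟨ -‿inverseʳ _ ⟩
    0#                                              ∎)

  coeff-Δ-top : ∀ p {n} → DegreeAtMost p (suc n) → coeff (Δ p) n ≈ fromℕ (suc n) * coeff p (suc n)
  coeff-Δ-top p {n} deg = begin
    coeff (Δ p) n                           ≈⟨ coeff--P (shift 1# p) p n ⟩
    coeff (shift 1# p) n + - coeff p n      ≈⟨ +-congʳ (coeff-shift-subtop 1# p deg) ⟩
    (coeff p n + k * 1# * u) + - coeff p n  ≈⟨ xyx⁻¹≈y (coeff p n) _ ⟩
    k * 1# * u                              ≈⟨ *-congʳ (*-identityʳ k) ⟩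
    k * u                                   ∎
    where
    k = fromℕ (suc n)
    u = coeff p (suc n)

module CharZeroPolynomials {c ℓ : Level} (F : Field c ℓ) (char0 : FieldTheory.CharZero F) where
  open FieldTheory F hiding (zero)
  open FieldProperties F
  open PolynomialProperties F

  Δ-degree⁻¹ : ∀ q n → DegreeAtMost (Δ q) n → DegreeAtMost q (suc n)
  Δ-degree⁻¹ q n degΔq = descend (length q) (degree-length q)
    where
    descend : ∀ m → DegreeAtMost q m → DegreeAtMost q (suc n)
    descend zero    deg = degree-mono z≤n deg
    descend (suc m) deg with m ℕ.≤? n
    ... | yes m≤n = degree-mono (s≤s m≤n) deg
    ... | no  m≰n = descend m (degree-pred deg (*-zero-cancelˡ (char0 m)
                      (trans (sym (coeff-Δ-top q deg)) (vanishes degΔq m (ℕ.≰⇒> m≰n)))))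

  vanishing-poly-≈P[] : ∀ n p → DegreeAtMost p n → (∀ x → eval x p ≈ 0#) → p ≈P []
  vanishing-poly-≈P[] zero    p deg p≈0 = degree0-≈P[] deg (trans (sym (eval-degree0 0# p deg)) (p≈0 0#))
  vanishing-poly-≈P[] (suc n) p deg p≈0 = vanishing-poly-≈P[] n p (degree-pred deg top≈0) p≈0
    where
    Δp≈0 : Δ p ≈P []
    Δp≈0 = vanishing-poly-≈P[] n (Δ p) (Δ-degree p deg) λ y →
      trans (eval-Δ y p) (trans (+-cong (p≈0 (y + 1#)) (-‿cong (p≈0 y))) (-‿inverseʳ 0#))
    top≈0 : coeff p (suc n) ≈ 0#
    top≈0 = *-zero-cancelˡ (char0 n) (trans (sym (coeff-Δ-top p deg)) (Δp≈0 n))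

  eval-injective : ∀ p q → (∀ x → eval x p ≈ eval x q) → p ≈P q
  eval-injective p q p≈q = -P≈P[]⇒≈P p q (vanishing-poly-≈P[] _ (p -P q) (degree-length (p -P q)) λ x →
    trans (eval--P x p q) (trans (+-congʳ (p≈q x)) (-‿inverseʳ _)))

module DeltaOperatorProperties {c ℓ : Level} (F : Field c ℓ) (char0 : FieldTheory.CharZero F)
                               (d : FieldTheory.Op F) (isDelta : FieldTheory.IsDeltaOperator F d) where
  open FieldTheory F hiding (zero)
  open FieldProperties F
  open PolynomialProperties F
  open CharZeroPolynomials F char0
  open IsDeltaOperator isDelta
  open IsShiftInvariant shiftInvariant
  open IsLinear linear
  open LinearOperator linear
  open import Algebra.Properties.Group +-group using (identityʳ-unique)
  open import Algebra.Solver.Ring.NaturalCoefficients.Default commutativeSemiring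
    using (solve; _:=_; _:+_; _:*_; con)
  open import Relation.Binary.Reasoning.Setoid setoid

  module Dⁱ (i : ℕ) = LinearOperator (iterate-isLinear linear i)

  eval-dX : ∀ x → eval x (d X) ≈ constant
  eval-dX x = trans (eval-cong x (d X) (const constant) onX) (eval-const x constant)

  d-const : d (const 1#) ≈P []
  d-const = eval-injective (d (const 1#)) [] λ y → identityʳ-unique constant _ (begin
    constant + eval y (d (const 1#))      ≈⟨ +-congʳ (eval-dX y) ⟨
    eval y (d X) + eval y (d (const 1#))  ≈⟨ eval-+P y (d X) (d (const 1#)) ⟨
    eval y (d X +P d (const 1#))          ≈⟨ eval-cong y (d (X +P const 1#)) (d X +P d (const 1#))
                                                       (additive X (const 1#)) ⟨
    eval y (d (X +P const 1#))            ≈⟨ eval-L-cong y (shift 1# X) (X +P const 1#) (shift-X 1#) ⟨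
    eval y (d (shift 1# X))               ≈⟨ eval-cong y (d (shift 1# X)) (shift 1# (d X)) (commutes 1# X) ⟩
    eval y (shift 1# (d X))               ≈⟨ eval-shift 1# y (d X) ⟩
    eval (y + 1#) (d X)                   ≈⟨ eval-dX (y + 1#) ⟩
    constant                              ∎)

  d-degree≤1 : ∀ p → DegreeAtMost p 1 → d p ≈P (coeff p 1 ·P const constant)
  d-degree≤1 p deg n = begin
    coeff (d p) n                                       ≈⟨ cong-≈P p (p₀·1 +P p₁·X) split n ⟩
    coeff (d (p₀·1 +P p₁·X)) n                          ≈⟨ additive p₀·1 p₁·X n ⟩
    coeff (d p₀·1 +P d p₁·X) n                          ≈⟨ coeff-+P (d p₀·1) (d p₁·X) n ⟩
    coeff (d p₀·1) n + coeff (d p₁·X) n                 ≈⟨ +-cong (homogeneous p₀ (const 1#) n) (homogeneous p₁ X n) ⟩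
    coeff (p₀ ·P d (const 1#)) n + coeff (p₁ ·P d X) n  ≈⟨ +-cong (coeff-·P p₀ (d (const 1#)) n) (coeff-·P p₁ (d X) n) ⟩
    p₀ * coeff (d (const 1#)) n + p₁ * coeff (d X) n    ≈⟨ +-cong (*-congˡ (d-const n)) (*-congˡ (onX n)) ⟩
    p₀ * 0# + p₁ * coeff (const constant) n             ≈⟨ +-congʳ (zeroʳ p₀) ⟩
    0# + p₁ * coeff (const constant) n                  ≈⟨ +-identityˡ _ ⟩
    p₁ * coeff (const constant) n                       ≈⟨ coeff-·P p₁ (const constant) n ⟨
    coeff (p₁ ·P const constant) n                      ∎
    where
    p₀ = coeff p 0
    p₁ = coeff p 1
    p₀·1 = p₀ ·P const 1#
    p₁·X = p₁ ·P X
    split : p ≈P (p₀·1 +P p₁·X)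
    split zero          = solve 2 (λ a b → a := a :* con 1 :+ b :* con 0) refl p₀ p₁
    split (suc zero)    = sym (*-identityʳ p₁)
    split (suc (suc n)) = vanishes deg (suc (suc n)) (s≤s (s≤s z≤n))

  d-Δ : ∀ p → d (Δ p) ≈P Δ (d p)
  d-Δ p m = begin
    coeff (d (shift 1# p -P p)) m               ≈⟨ L--P (shift 1# p) p m ⟩
    coeff (d (shift 1# p) -P d p) m             ≈⟨ coeff--P (d (shift 1# p)) (d p) m ⟩
    coeff (d (shift 1# p)) m + - coeff (d p) m  ≈⟨ +-congʳ (commutes 1# p m) ⟩
    coeff (shift 1# (d p)) m + - coeff (d p) m  ≈⟨ coeff--P (shift 1# (d p)) (d p) m ⟨
    coeff (Δ (d p)) m                           ∎

  d-degree : ∀ n p → DegreeAtMost p (suc n) → DegreeAtMost (d p) n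
  d-degree zero    p deg = degree≤ λ { (suc m) _ →
    trans (d-degree≤1 p deg (suc m)) (trans (coeff-·P (coeff p 1) (const constant) (suc m)) (zeroʳ _)) }
  d-degree (suc n) p deg = Δ-degree⁻¹ (d p) n (degree-cong (d-Δ p) (d-degree n (Δ p) (Δ-degree p deg)))

  coeff-d-top : ∀ n p → DegreeAtMost p (suc n) → coeff (d p) n ≈ fromℕ (suc n) * constant * coeff p (suc n)
  coeff-d-top zero    p deg = begin
    coeff (d p) 0                   ≈⟨ d-degree≤1 p deg 0 ⟩
    coeff p 1 * constant            ≈⟨ solve 2 (λ a c → a :* c := (con 1 :+ con 0) :* c :* a) refl (coeff p 1) constant ⟩
    fromℕ 1 * constant * coeff p 1  ∎
  coeff-d-top (suc n) p deg = *-cancelˡ (char0 n) (begin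
    k * coeff (d p) (suc n)             ≈⟨ coeff-Δ-top (d p) (d-degree (suc n) p deg) ⟨
    coeff (Δ (d p)) n                   ≈⟨ d-Δ p n ⟨
    coeff (d (Δ p)) n                   ≈⟨ coeff-d-top n (Δ p) (Δ-degree p deg) ⟩
    k * constant * coeff (Δ p) (suc n)  ≈⟨ *-congˡ (coeff-Δ-top p deg) ⟩
    k * constant * (k′ * u)             ≈⟨ reorder k constant k′ u ⟩
    k * (k′ * constant * u)             ∎)
    where
    k = fromℕ (suc n)
    k′ = fromℕ (suc (suc n))
    u = coeff p (suc (suc n))
    reorder : ∀ k c k′ u → k * c * (k′ * u) ≈ k * (k′ * c * u)
    reorder = solve 4 (λ k c k′ u → k :* c :* (k′ :* u) := k :* (k′ :* c :* u)) refl

  iterate-degree : ∀ i {k p} → DegreeAtMost p (i ℕ.+ k) → DegreeAtMost (iter d i p) k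
  iterate-degree zero            deg = deg
  iterate-degree (suc i) {k} {p} deg =
    ≡.subst (λ q → DegreeAtMost q k) (≡.sym (iter-suc d i p)) (iterate-degree i (d-degree (i ℕ.+ k) p deg))

  iterate-top : ∀ i {k p} → DegreeAtMost p (i ℕ.+ k) → coeff (iter d i p) k ≈ 0# → coeff p (i ℕ.+ k) ≈ 0#
  iterate-top zero            deg top≈0 = top≈0
  iterate-top (suc i) {k} {p} deg top≈0 = *-zero-cancelˡ (*-nonzero (char0 (i ℕ.+ k)) constant≉0)
    (trans (sym (coeff-d-top (i ℕ.+ k) p deg))
           (iterate-top i (d-degree (i ℕ.+ k) p deg) (≡.subst (λ q → coeff q k ≈ 0#) (iter-suc d i p) top≈0)))

  iter-shift : ∀ i a p → iter d i (shift a p) ≈P shift a (iter d i p)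
  iter-shift zero    a p n = refl
  iter-shift (suc i) a p n = trans (cong-≈P _ _ (iter-shift i a p) n) (commutes a (iter d i p) n)

  eval-iter-shift : ∀ x y i p → eval x (iter d i (shift y p)) ≈ eval (x + y) (iter d i p)
  eval-iter-shift x y i p =
    trans (eval-cong x (iter d i (shift y p)) (shift y (iter d i p)) (iter-shift i y p)) (eval-shift y x (iter d i p))

  module Interpolation (z : ℕ → Carrier) where

    private
      top≈0 : ∀ n p → DegreeAtMost p n → eval (z n) (iter d n p) ≈ 0# → coeff p n ≈ 0#
      top≈0 n p deg dⁿp≈0 = ≡.subst (λ m → coeff p m ≈ 0#) (ℕ.+-identityʳ n)
        (iterate-top n deg′ (trans (sym (eval-degree0 (z n) (iter d n p) (iterate-degree n deg′))) dⁿp≈0))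
        where deg′ = ≡.subst (DegreeAtMost p) (≡.sym (ℕ.+-identityʳ n)) deg

    interpolation-≈P[] : ∀ n p → DegreeAtMost p n → (∀ i → i ≤ n → eval (z i) (iter d i p) ≈ 0#) → p ≈P []
    interpolation-≈P[] zero    p deg vanish = degree0-≈P[] deg (top≈0 0 p deg (vanish 0 z≤n))
    interpolation-≈P[] (suc n) p deg vanish =
      interpolation-≈P[] n p (degree-pred deg (top≈0 (suc n) p deg (vanish (suc n) ℕ.≤-refl)))
                         (λ i i≤n → vanish i (ℕ.m≤n⇒m≤1+n i≤n))

    interpolation-unique : ∀ n p q → DegreeAtMost p n → DegreeAtMost q n →
      (∀ i → i ≤ n → eval (z i) (iter d i p) ≈ eval (z i) (iter d i q)) → p ≈P q
    interpolation-unique n p q degp degq same = -P≈P[]⇒≈P p q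
      (interpolation-≈P[] n (p -P q) (degree--P degp degq) λ i i≤n → begin
        eval (z i) (iter d i (p -P q))                       ≈⟨ eval-cong (z i) (iter d i (p -P q)) (iter d i p -P iter d i q)
                                                                         (Dⁱ.L--P i p q) ⟩
        eval (z i) (iter d i p -P iter d i q)                ≈⟨ eval--P (z i) (iter d i p) (iter d i q) ⟩
        eval (z i) (iter d i p) + - eval (z i) (iter d i q)  ≈⟨ +-congʳ (same i i≤n) ⟩
        eval (z i) (iter d i q) + - eval (z i) (iter d i q)  ≈⟨ -‿inverseʳ _ ⟩
        0#                                                   ∎)

module GoncharovBasisProperties {c ℓ : Level} (F : Field c ℓ) (char0 : FieldTheory.CharZero F)
  (d : FieldTheory.Op F) (isDelta : FieldTheory.IsDeltaOperator F d)
  (z : ℕ → FieldTheory.Carrier F) (t : ℕ → FieldTheory.Poly F) (basis : FieldTheory.IsGoncharovBasis F d z t) where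
  open FieldTheory F hiding (zero)
  open FieldProperties F
  open PolynomialProperties F
  open CharZeroPolynomials F char0
  open DeltaOperatorProperties F char0 d isDelta
  open Interpolation z
  open IsDeltaOperator isDelta
  open IsShiftInvariant shiftInvariant
  open IsGoncharovBasis basis
  open import Algebra.Solver.Ring.NaturalCoefficients.Default commutativeSemiring
    using (solve; _:=_; _:+_; _:*_)
  open import Relation.Binary.Reasoning.Setoid setoid

  basis-degree : ∀ n → DegreeAtMost (t n) n
  basis-degree n = degree≤ (proj₂ (degree n))

  factδ-diag : ∀ n → factδ n n ≈ fromℕ (n !)
  factδ-diag n rewrite dec-true (n ℕ.≟ n) ≡.refl = refl

  factδ-off : ∀ {i n} → i ≢ n → factδ i n ≈ 0#
  factδ-off {i} {n} i≢n rewrite dec-false (i ℕ.≟ n) i≢n = refl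

  factδ-suc : ∀ i n → factδ (suc i) (suc n) ≈ fromℕ (suc n) * factδ i n
  factδ-suc i n with i ℕ.≟ n
  ... | yes ≡.refl = trans (factδ-diag (suc i)) (trans (fromℕ-* (suc i) (i !)) (*-congˡ (sym (factδ-diag i))))
  ... | no  i≢n    = trans (factδ-off (λ 1+i≡1+n → i≢n (ℕ.suc-injective 1+i≡1+n)))
                           (sym (trans (*-congˡ (factδ-off i≢n)) (zeroʳ _)))

  interpolation-off : ∀ {i n} → i ≢ n → eval (z i) (iter d i (t n)) ≈ 0#
  interpolation-off {i} {n} i≢n = trans (interpolation i n) (factδ-off i≢n)

  eval-iter-combination : ∀ n {i} (a : ℕ → Carrier) → i ≤ n →
    eval (z i) (iter d i (sumP n (λ k → a k ·P t k))) ≈ a i * fromℕ (i !)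
  eval-iter-combination n {i} a i≤n = begin
    eval (z i) (iter d i (sumP n f))             ≈⟨ eval-cong (z i) (iter d i (sumP n f)) (sumP n (λ k → iter d i (f k)))
                                                              (Dⁱ.L-sumP i n f) ⟩
    eval (z i) (sumP n (λ k → iter d i (f k)))   ≈⟨ eval-sumP (z i) n (λ k → iter d i (f k)) ⟩
    sumTo n (λ k → eval (z i) (iter d i (f k)))  ≈⟨ sumTo-cong n (λ k → trans (Dⁱ.eval-L-·P i (z i) (a k) (t k))
                                                                             (*-congˡ (interpolation i k))) ⟩
    sumTo n (λ k → a k * factδ i k)              ≈⟨ sumTo-single (λ k → a k * factδ i k) i≤n
                                                      (λ k k≢i → trans (*-congˡ (factδ-off (≡.≢-sym k≢i))) (zeroʳ _)) ⟩
    a i * factδ i i                              ≈⟨ *-congˡ (factδ-diag i) ⟩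
    a i * fromℕ (i !)                            ∎
    where
    f : ℕ → Poly
    f k = a k ·P t k

  expansion : Carrier → ℕ → Poly
  expansion y n = sumP n (λ k → (fromℕ (n C k) * eval y (t (n ∸ k))) ·P t k)

  expansion-degree : ∀ y n → DegreeAtMost (expansion y n) n
  expansion-degree y n = degree-sumP n (λ k k≤n → degree-·P _ (degree-mono k≤n (basis-degree k)))

  eval-expansion : ∀ x y n →
    eval x (expansion y n) ≈ sumTo n (λ k → fromℕ (n C k) * (eval x (t k) * eval y (t (n ∸ k))))
  eval-expansion x y n = trans (eval-sumP x n _) (sumTo-cong n λ k →
    trans (eval-·P x _ (t k)) (solve 3 (λ c v u → (c :* v) :* u := c :* (u :* v)) refl _ _ _))

  eval-iter-expansion : ∀ i m y →
    fromℕ (m !) * eval (z i) (iter d i (expansion y (i ℕ.+ m))) ≈ fromℕ ((i ℕ.+ m) !) * eval y (t m)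
  eval-iter-expansion i m y = begin
    fromℕ (m !) * eval (z i) (iter d i (expansion y (i ℕ.+ m)))
      ≈⟨ *-congˡ (eval-iter-combination (i ℕ.+ m) _ (ℕ.m≤m+n i m)) ⟩
    fromℕ (m !) * (fromℕ 𝐶 * eval y (t (i ℕ.+ m ∸ i)) * fromℕ (i !))
      ≡⟨ ≡.cong (λ k → fromℕ (m !) * (fromℕ 𝐶 * eval y (t k) * fromℕ (i !))) (ℕ.m+n∸m≡n i m) ⟩
    fromℕ (m !) * (fromℕ 𝐶 * eval y (t m) * fromℕ (i !))
      ≈⟨ reorder (fromℕ (m !)) (fromℕ 𝐶) (fromℕ (i !)) (eval y (t m)) ⟩
    fromℕ 𝐶 * (fromℕ (i !) * fromℕ (m !)) * eval y (t m)
      ≈⟨ *-congʳ (trans (fromℕ-* 𝐶 (i ! ℕ.* m !)) (*-congˡ (fromℕ-* (i !) (m !)))) ⟨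
    fromℕ (𝐶 ℕ.* (i ! ℕ.* m !)) * eval y (t m)
      ≡⟨ ≡.cong (λ k → fromℕ k * eval y (t m)) (binomial-factorials i m) ⟩
    fromℕ ((i ℕ.+ m) !) * eval y (t m)
      ∎
    where
    𝐶 = (i ℕ.+ m) C i
    reorder : ∀ a b c u → a * (b * u * c) ≈ b * (c * a) * u
    reorder = solve 4 (λ a b c u → a :* (b :* u :* c) := b :* (c :* a) :* u) refl

  ExpandsUnderShift : Set (c ⊔ ℓ)
  ExpandsUnderShift = ∀ y n → shift y (t n) ≈P expansion y n

  ShiftedIterates : Set (c ⊔ ℓ)
  ShiftedIterates = ∀ i m y →
    fromℕ (m !) * eval (z i + y) (iter d i (t (i ℕ.+ m))) ≈ fromℕ ((i ℕ.+ m) !) * eval y (t m)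

  isBinomialType⇒expandsUnderShift : IsBinomialType t → ExpandsUnderShift
  isBinomialType⇒expandsUnderShift binomial y n = eval-injective (shift y (t n)) (expansion y n) λ x → begin
    eval x (shift y (t n))                                                ≈⟨ eval-shift y x (t n) ⟩
    eval (x + y) (t n)                                                    ≈⟨ binomial n x y ⟩
    sumTo n (λ k → fromℕ (n C k) * (eval x (t k) * eval y (t (n ∸ k))))  ≈⟨ eval-expansion x y n ⟨
    eval x (expansion y n)                                                ∎

  expandsUnderShift⇒isBinomialType : ExpandsUnderShift → IsBinomialType t
  expandsUnderShift⇒isBinomialType expands n x y = begin
    eval (x + y) (t n)                                                    ≈⟨ eval-shift y x (t n) ⟨
    eval x (shift y (t n))                                                ≈⟨ eval-cong x (shift y (t n)) (expansion y n)
                                                                                       (expands y n) ⟩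
    eval x (expansion y n)                                                ≈⟨ eval-expansion x y n ⟩
    sumTo n (λ k → fromℕ (n C k) * (eval x (t k) * eval y (t (n ∸ k))))  ∎

  expandsUnderShift⇒shiftedIterates : ExpandsUnderShift → ShiftedIterates
  expandsUnderShift⇒shiftedIterates expands i m y = begin
    fromℕ (m !) * eval (z i + y) (iter d i (t n))        ≈⟨ *-congˡ (eval-iter-shift (z i) y i (t n)) ⟨
    fromℕ (m !) * eval (z i) (iter d i (shift y (t n)))  ≈⟨ *-congˡ (Dⁱ.eval-L-cong i (z i) (shift y (t n)) (expansion y n)
                                                                                           (expands y n)) ⟩
    fromℕ (m !) * eval (z i) (iter d i (expansion y n))  ≈⟨ eval-iter-expansion i m y ⟩
    fromℕ (n !) * eval y (t m)                           ∎
    where n = i ℕ.+ m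

  shiftedIterates⇒expandsUnderShift : ShiftedIterates → ExpandsUnderShift
  shiftedIterates⇒expandsUnderShift shifted y n =
    interpolation-unique n (shift y (t n)) (expansion y n) (shift-degree y (t n) (basis-degree n)) (expansion-degree y n)
      λ i i≤n → ≡.subst (λ n → eval (z i) (iter d i (shift y (t n))) ≈ eval (z i) (iter d i (expansion y n)))
                        (ℕ.m+[n∸m]≡n i≤n) (same-data i (n ∸ i))
    where
    same-data : ∀ i m → eval (z i) (iter d i (shift y (t (i ℕ.+ m)))) ≈ eval (z i) (iter d i (expansion y (i ℕ.+ m)))
    same-data i m = *-cancelˡ (fromℕ[n!]≉0 char0 m) (begin
      fromℕ (m !) * eval (z i) (iter d i (shift y (t (i ℕ.+ m))))  ≈⟨ *-congˡ (eval-iter-shift (z i) y i (t (i ℕ.+ m))) ⟩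
      fromℕ (m !) * eval (z i + y) (iter d i (t (i ℕ.+ m)))        ≈⟨ shifted i m y ⟩
      fromℕ ((i ℕ.+ m) !) * eval y (t m)                           ≈⟨ eval-iter-expansion i m y ⟨
      fromℕ (m !) * eval (z i) (iter d i (expansion y (i ℕ.+ m)))  ∎)

  arithmetic⇒shiftedIterates : ∀ b → (∀ i → z i ≈ fromℕ i * b) → ShiftedIterates
  arithmetic⇒shiftedIterates b z≈ib = shifted
    where
    step : ∀ i → z (suc i) ≈ z i + b
    step = arithmetic⇒step z≈ib

    shift-d-basis : ∀ m → shift b (d (t (suc m))) ≈P (fromℕ (suc m) ·P t m)
    shift-d-basis m = interpolation-unique m (shift b (d T)) (fromℕ (suc m) ·P t m)
      (shift-degree b (d T) (d-degree m T (basis-degree (suc m)))) (degree-·P _ (basis-degree m)) λ i _ → begin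
        eval (z i) (iter d i (shift b (d T)))         ≈⟨ eval-iter-shift (z i) b i (d T) ⟩
        eval (z i + b) (iter d i (d T))               ≈⟨ eval-at-cong (iter d i (d T)) (step i) ⟨
        eval (z (suc i)) (iter d i (d T))             ≡⟨ ≡.cong (eval (z (suc i))) (iter-suc d i T) ⟨
        eval (z (suc i)) (iter d (suc i) T)           ≈⟨ interpolation (suc i) (suc m) ⟩
        factδ (suc i) (suc m)                         ≈⟨ factδ-suc i m ⟩
        fromℕ (suc m) * factδ i m                     ≈⟨ *-congˡ (interpolation i m) ⟨
        fromℕ (suc m) * eval (z i) (iter d i (t m))   ≈⟨ Dⁱ.eval-L-·P i (z i) (fromℕ (suc m)) (t m) ⟨
        eval (z i) (iter d i (fromℕ (suc m) ·P t m))  ∎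
      where T = t (suc m)

    shifted : ShiftedIterates
    shifted zero    m y = *-congˡ (eval-at-cong (t m) (trans (+-congʳ (trans (z≈ib 0) (zeroˡ b))) (+-identityˡ y)))
    shifted (suc i) m y = begin
      fromℕ (m !) * eval (z (suc i) + y) (iter d (suc i) T)
        ≡⟨ ≡.cong (λ q → fromℕ (m !) * eval (z (suc i) + y) q) (iter-suc d i T) ⟩
      fromℕ (m !) * eval (z (suc i) + y) (iter d i (d T))
        ≈⟨ *-congˡ (eval-at-cong (iter d i (d T)) z₁₊ᵢ+y≈zᵢ+y+b) ⟩
      fromℕ (m !) * eval ((z i + y) + b) (iter d i (d T))
        ≈⟨ *-congˡ (eval-iter-shift (z i + y) b i (d T)) ⟨
      fromℕ (m !) * eval (z i + y) (iter d i (shift b (d T)))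
        ≈⟨ *-congˡ (Dⁱ.eval-L-cong i (z i + y) (shift b (d T)) (k ·P t (i ℕ.+ m)) (shift-d-basis (i ℕ.+ m))) ⟩
      fromℕ (m !) * eval (z i + y) (iter d i (k ·P t (i ℕ.+ m)))
        ≈⟨ *-congˡ (Dⁱ.eval-L-·P i (z i + y) k (t (i ℕ.+ m))) ⟩
      fromℕ (m !) * (k * e)
        ≈⟨ x*[y*z]≈y*[x*z] (fromℕ (m !)) k e ⟩
      k * (fromℕ (m !) * e)
        ≈⟨ *-congˡ (shifted i m y) ⟩
      k * (fromℕ ((i ℕ.+ m) !) * eval y (t m))
        ≈⟨ *-assoc k _ _ ⟨
      k * fromℕ ((i ℕ.+ m) !) * eval y (t m)
        ≈⟨ *-congʳ (fromℕ-* (suc (i ℕ.+ m)) ((i ℕ.+ m) !)) ⟨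
      fromℕ ((suc i ℕ.+ m) !) * eval y (t m)
        ∎
      where
      T = t (suc (i ℕ.+ m))
      k = fromℕ (suc (i ℕ.+ m))
      e = eval (z i + y) (iter d i (t (i ℕ.+ m)))
      z₁₊ᵢ+y≈zᵢ+y+b : z (suc i) + y ≈ (z i + y) + b
      z₁₊ᵢ+y≈zᵢ+y+b = trans (+-congʳ (step i)) (solve 3 (λ u b y → (u :+ b) :+ y := (u :+ y) :+ b) refl (z i) b y)
      x*[y*z]≈y*[x*z] : ∀ x y z → x * (y * z) ≈ y * (x * z)
      x*[y*z]≈y*[x*z] = solve 3 (λ x y z → x :* (y :* z) := y :* (x :* z)) refl

  shiftedIterates⇒arithmetic : ShiftedIterates → Σ Carrier (λ b → ∀ i → z i ≈ fromℕ i * b)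
  shiftedIterates⇒arithmetic shifted = z 1 , step⇒arithmetic z₀≈0 step
    where
    z₀≈0 : z 0 ≈ 0#
    z₀≈0 = trans (sym (+-identityʳ (z 0)))
      (degree1-injective (basis-degree 1) (proj₁ (degree 1)) (*-cancelˡ (char0 0) (shifted 0 1 0#)))

    dt₂ = d (t 2)

    dt₂-degree : DegreeAtMost dt₂ 1
    dt₂-degree = d-degree 1 (t 2) (basis-degree 2)

    dt₂-slope≉0 : ¬ (coeff dt₂ 1 ≈ 0#)
    dt₂-slope≉0 slope≈0 = *-nonzero (*-nonzero (char0 1) constant≉0) (proj₁ (degree 2))
                                    (trans (sym (coeff-d-top 1 (t 2) (basis-degree 2))) slope≈0)

    gap : ℕ → Carrier
    gap i = z (suc i) + - z i

    dt₂-vanishes-at-gap : ∀ i → eval (gap i) dt₂ ≈ 0#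
    dt₂-vanishes-at-gap i = *-zero-cancelˡ (fromℕ[n!]≉0 char0 (i ℕ.+ 2)) (begin
      K * eval (gap i) dt₂
        ≈⟨ eval-L-·P (gap i) K (t 2) ⟨
      eval (gap i) (d (K ·P t 2))
        ≈⟨ eval-L-cong (gap i) (K ·P t 2) (fromℕ 2 ·P P) (λ n → sym (scaled n)) ⟩
      eval (gap i) (d (fromℕ 2 ·P P))
        ≈⟨ eval-L-·P (gap i) (fromℕ 2) P ⟩
      fromℕ 2 * eval (gap i) (d P)
        ≈⟨ *-congˡ (eval-cong (gap i) (d P) (shift (z i) dⁱ⁺¹T) (commutes (z i) (iter d i T))) ⟩
      fromℕ 2 * eval (gap i) (shift (z i) dⁱ⁺¹T)
        ≈⟨ *-congˡ (eval-shift (z i) (gap i) dⁱ⁺¹T) ⟩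
      fromℕ 2 * eval (gap i + z i) dⁱ⁺¹T
        ≈⟨ *-congˡ (eval-at-cong dⁱ⁺¹T ([x-y]+y≈x (z (suc i)) (z i))) ⟩
      fromℕ 2 * eval (z (suc i)) dⁱ⁺¹T
        ≈⟨ *-congˡ (interpolation-off 1+i≢i+2) ⟩
      fromℕ 2 * 0#
        ≈⟨ zeroʳ _ ⟩
      0#
        ∎)
      where
      open LinearOperator linear using (eval-L-cong; eval-L-·P)
      T = t (i ℕ.+ 2)
      dⁱ⁺¹T = iter d (suc i) T
      K = fromℕ ((i ℕ.+ 2) !)
      P = shift (z i) (iter d i T)
      scaled : (fromℕ 2 ·P P) ≈P (K ·P t 2)
      scaled = eval-injective (fromℕ 2 ·P P) (K ·P t 2) λ y → begin
        eval y (fromℕ 2 ·P P)                  ≈⟨ eval-·P y (fromℕ 2) P ⟩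
        fromℕ 2 * eval y P                     ≈⟨ *-congˡ (trans (eval-shift (z i) y (iter d i T))
                                                                 (eval-at-cong (iter d i T) (+-comm y (z i)))) ⟩
        fromℕ 2 * eval (z i + y) (iter d i T)  ≈⟨ shifted i 2 y ⟩
        K * eval y (t 2)                       ≈⟨ eval-·P y K (t 2) ⟨
        eval y (K ·P t 2)                      ∎
      1+i≢i+2 : suc i ≢ i ℕ.+ 2
      1+i≢i+2 = ℕ.<⇒≢ (ℕ.≤-reflexive (≡.sym (ℕ.+-comm i 2)))

    step : ∀ i → z (suc i) ≈ z i + z 1
    step i = begin
      z (suc i)    ≈⟨ [x-y]+y≈x (z (suc i)) (z i) ⟨
      gap i + z i  ≈⟨ +-congʳ (degree1-injective dt₂-degree dt₂-slope≉0
                        (trans (dt₂-vanishes-at-gap i) (sym (interpolation-off {1} {2} (λ ()))))) ⟩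
      z 1 + z i    ≈⟨ +-comm (z 1) (z i) ⟩
      z i + z 1    ∎

proposition3p14 : {c ℓ : Level} (F : Field c ℓ) →
    let open FieldTheory F in
    CharZero → (d : Op) → IsDeltaOperator d → (z : ℕ → Carrier) → (t : ℕ → Poly) →
    IsGoncharovBasis d z t →
    (IsBinomialType t ⇔ Σ Carrier (λ b → ∀ i → z i ≈ fromℕ i * b))
proposition3p14 F char0 d isDelta z t basis = mk⇔
  (λ binomial → shiftedIterates⇒arithmetic
                  (expandsUnderShift⇒shiftedIterates (isBinomialType⇒expandsUnderShift binomial)))
  (λ (b , z≈ib) → expandsUnderShift⇒isBinomialType
                    (shiftedIterates⇒expandsUnderShift (arithmetic⇒shiftedIterates b z≈ib)))
  where open GoncharovBasisProperties F char0 d isDelta z t basis
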